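{- Let $n > 0$ and $P \subseteq \{0,1,\ldots,n-1\}$. Let $p, q \in P$ with $0 \leq p < q < 2p$ and $2p - q \notin P$, and suppose there is an integer $i$ with $2 \leq i \leq \min(\lfloor p/(q-p)\rfloor, \lfloor (n-p)/(q-p)\rfloor)$ such that $r := p - i(q-p) \in P$ (i.e., the pair $(p,q)$ violates the Backward Propagation Rule). Then the pair $(p-r, q-r)$ violates the Fine and Wilf condition at length $n-r$, that is, $FW(p-r, q-r) \leq n - r$.
   Context: For positive integers $a, b$, the Fine and Wilf limit is $FW(a,b) := a + b - \gcd(a,b)$, and a pair $(a,b)$ is said to violate the Fine and Wilf condition at length $m$ if $FW(a,b) \leq m$. A set $P \subseteq \{0,\ldots,n-1\}$ satisfies the Backward Propagation Rule (BPR) iff for all pairs $p,q \in P$ with $0 \leq p < q < 2p$ and $2p-q \notin P$, one has $p - i(q-p) \notin P$ for all $i = 2,\ldots,\min(\lfloor p/(q-p)\rfloor, \lfloor (n-p)/(q-p)\rfloor)$; a pair violates the BPR if this fails for it. -}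

module Defs where

open import Data.Nat using (ℕ; _+_; _*_; _∸_; _≤_; _<_; _⊓_; _/_; >-nonZero)
open import Data.Nat.Properties using (m<n⇒0<n∸m)
open import Data.Nat.GCD using (gcd)
open import Data.Product using (Σ; _×_)
open import Relation.Nullary using (¬_)

FW : ℕ → ℕ → ℕ
FW a b = a + b ∸ gcd a b

ViolatesFW : ℕ → ℕ → ℕ → Set
ViolatesFW a b m = FW a b ≤ m

divGap : (a p q : ℕ) → p < q → ℕ
divGap a p q p<q = _/_ a (q ∸ p) {{>-nonZero (m<n⇒0<n∸m p<q)}}

ViolatesBPRWith : (n : ℕ) (P : ℕ → Set) (p q i : ℕ) → Set
ViolatesBPRWith n P p q i =
  P p × P q × Σ (p < q) λ p<q → q < 2 * p × ¬ P (2 * p ∸ q)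
  × 2 ≤ i × i ≤ (divGap p p q p<q ⊓ divGap (n ∸ p) p q p<q)
  × P (p ∸ i * (q ∸ p))

ViolatesBPR : (n : ℕ) (P : ℕ → Set) (p q : ℕ) → Set
ViolatesBPR n P p q = Σ ℕ λ i → ViolatesBPRWith n P p q i

{-# OPTIONS --safe #-}
-- With d = q ∸ p and x = i * d we get p ∸ r = x and q ∸ r = x + d. As d divides
-- both x and x + d, gcd x (x + d) ≥ d, so FW x (x + d) ≤ 2x; and i ≤ (n ∸ p) / d
-- gives p + x ≤ n, i.e. 2x ≤ n ∸ r.
module Submission where

open import Defs
open import Data.Nat using (ℕ; _<_; _∸_; _*_; _+_; _≤_; _/_; NonZero; ≢-nonZero; ≢-nonZero⁻¹; >-nonZero; >-nonZero⁻¹)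
open import Data.Nat.Properties
open import Data.Nat.DivMod using (m/n*n≤m)
open import Data.Nat.Divisibility using (_∣_; ∣⇒≤; ∣m∣n⇒∣m+n; ∣-refl; n∣m*n)
open import Data.Nat.GCD using (gcd; gcd-greatest; gcd[m,n]≢0)
open import Data.Sum using (inj₂)
open import Data.Product using (_,_)
open import Relation.Binary.PropositionalEquality using (_≡_; cong; cong₂; module ≡-Reasoning)

FW≤+∸-divisor : ∀ {a b d} .{{_ : NonZero b}} → d ∣ a → d ∣ b → FW a b ≤ a + b ∸ d
FW≤+∸-divisor {a} {b} d∣a d∣b = ∸-monoʳ-≤ (a + b) (∣⇒≤ {{gcd≢0}} (gcd-greatest d∣a d∣b))
  where
  gcd≢0 : NonZero (gcd a b)
  gcd≢0 = ≢-nonZero (gcd[m,n]≢0 a b (inj₂ (≢-nonZero⁻¹ b)))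

FW[m,m+d]≤m+m : ∀ {m d} .{{_ : NonZero d}} → d ∣ m → FW m (m + d) ≤ m + m
FW[m,m+d]≤m+m {m} {d} d∣m = begin
  FW m (m + d)      ≤⟨ FW≤+∸-divisor {{m+d≢0}} d∣m (∣m∣n⇒∣m+n d∣m ∣-refl) ⟩
  m + (m + d) ∸ d   ≡⟨ cong (_∸ d) (+-assoc m m d) ⟨
  m + m + d ∸ d     ≡⟨ m+n∸n≡m (m + m) d ⟩
  m + m             ∎
  where
  open ≤-Reasoning
  m+d≢0 : NonZero (m + d)
  m+d≢0 = >-nonZero (≤-trans (>-nonZero⁻¹ d) (m≤n+m d m))

m≤n/o⇒m*o≤n : ∀ {m n o} .{{_ : NonZero o}} → m ≤ n / o → m * o ≤ n
m≤n/o⇒m*o≤n {n = n} {o} m≤n/o = ≤-trans (*-monoˡ-≤ o m≤n/o) (m/n*n≤m n o)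

o∸[n∸m]≡m+[o∸n] : ∀ {m n o} → m ≤ n → n ≤ o → o ∸ (n ∸ m) ≡ m + (o ∸ n)
o∸[n∸m]≡m+[o∸n] {m} {n} {o} m≤n n≤o = begin
  o ∸ (n ∸ m)               ≡⟨ cong (_∸ (n ∸ m)) (m∸n+n≡m n≤o) ⟨
  (o ∸ n) + n ∸ (n ∸ m)     ≡⟨ +-∸-assoc (o ∸ n) (m∸n≤m n m) ⟩
  (o ∸ n) + (n ∸ (n ∸ m))   ≡⟨ cong ((o ∸ n) +_) (m∸[m∸n]≡n m≤n) ⟩
  (o ∸ n) + m               ≡⟨ +-comm (o ∸ n) m ⟩
  m + (o ∸ n)               ∎
  where open ≡-Reasoning

lemma2 : (n : ℕ) → 0 < n → (P : ℕ → Set) → (∀ x → P x → x < n) →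
    (p q i : ℕ) → ViolatesBPRWith n P p q i →
    let r = p ∸ i * (q ∸ p) in
    ViolatesFW (p ∸ r) (q ∸ r) (n ∸ r)
lemma2 n _ P P<n p q i (Pp , _ , p<q , _ , _ , _ , i≤min , _) = begin
  FW (p ∸ r) (q ∸ r)  ≡⟨ cong₂ FW (m∸[m∸n]≡n x≤p) (o∸[n∸m]≡m+[o∸n] x≤p (<⇒≤ p<q)) ⟩
  FW x (x + d)        ≤⟨ FW[m,m+d]≤m+m (n∣m*n i) ⟩
  x + x               ≤⟨ m+n≤o⇒m≤o∸n (x + x) x+x+r≤n ⟩
  n ∸ r               ∎
  where
  open ≤-Reasoning
  d = q ∸ p
  x = i * d
  r = p ∸ x
  instance
    d≢0 : NonZero d
    d≢0 = >-nonZero (m<n⇒0<n∸m p<q)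
  x≤p : x ≤ p
  x≤p = m≤n/o⇒m*o≤n (≤-trans i≤min (m⊓n≤m _ _))
  x≤n∸p : x ≤ n ∸ p
  x≤n∸p = m≤n/o⇒m*o≤n (≤-trans i≤min (m⊓n≤n _ _))
  x+x+r≤n : x + x + r ≤ n
  x+x+r≤n = begin
    x + x + r    ≡⟨ +-assoc x x r ⟩
    x + (x + r)  ≡⟨ cong (x +_) (m+[n∸m]≡n x≤p) ⟩
    x + p        ≤⟨ m≤o∸n⇒m+n≤o x (<⇒≤ (P<n p Pp)) x≤n∸p ⟩
    n            ∎
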